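{- Let $n\geq 1$ and let $G$ be a simple graph of order $2n$ having a perfect matching, with $F(G)=n-1$. Then the forcing spectrum of $G$ is continuous, i.e., the set $\{f(G,M): M \text{ a perfect matching of } G\}$ is an integer interval.
   Context: For a perfect matching $M$ of a graph $G$, a forcing set of $M$ is a subset of $M$ contained in no other perfect matching of $G$; the forcing number $f(G,M)$ is the smallest cardinality of a forcing set of $M$. The maximum forcing number $F(G)$ is the maximum of $f(G,M)$ over all perfect matchings $M$ of $G$. The forcing spectrum of $G$ is the set of forcing numbers of all perfect matchings of $G$. -}

module Defs where

open import Data.Nat using (ℕ; _≤_; _<ᵇ_)
open import Data.Bool using (Bool; true; false; _∧_; if_then_else_)
open import Data.Fin using (Fin; toℕ)
open import Data.List using (List; map; allFin)
open import Data.Nat.ListAction using (sum)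
open import Data.Product using (Σ; ∃; _×_)
open import Relation.Binary.PropositionalEquality using (_≡_)

record SimpleGraph (m : ℕ) : Set where
  field
    adj    : Fin m → Fin m → Bool
    sym    : ∀ i j → adj i j ≡ adj j i
    irrefl : ∀ i → adj i i ≡ false
open SimpleGraph public

-- A set of edges on Fin m, given as a symmetric Boolean relation
-- (S i j ≡ true means the edge {i,j} belongs to the set).
EdgeRel : ℕ → Set
EdgeRel m = Fin m → Fin m → Bool

SymmetricE : ∀ {m} → EdgeRel m → Set
SymmetricE S = ∀ i j → S i j ≡ S j i

_⊆ₑ_ : ∀ {m} → EdgeRel m → EdgeRel m → Set
S ⊆ₑ T = ∀ i j → S i j ≡ true → T i j ≡ true

-- number of edges {i,j} (counted once, via i < j)
edgeCount : ∀ {m} → EdgeRel m → ℕ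
edgeCount {m} S =
  sum (map (λ i → sum (map (λ j → if (toℕ i <ᵇ toℕ j) ∧ S i j then 1 else 0)
                           (allFin m)))
           (allFin m))

IsPerfectMatching : ∀ {m} → SimpleGraph m → EdgeRel m → Set
IsPerfectMatching G M =
  SymmetricE M × (M ⊆ₑ adj G) ×
  (∀ i → ∃ λ j → (M i j ≡ true) × (∀ k → M i k ≡ true → k ≡ j))

IsForcingSet : ∀ {m} → SimpleGraph m → EdgeRel m → EdgeRel m → Set
IsForcingSet G M S =
  SymmetricE S × (S ⊆ₑ M) ×
  (∀ M' → IsPerfectMatching G M' → S ⊆ₑ M' → ∀ i j → M' i j ≡ M i j)

ForcingNumber : ∀ {m} → SimpleGraph m → EdgeRel m → ℕ → Set
ForcingNumber G M k =
  (∃ λ S → IsForcingSet G M S × edgeCount S ≡ k) ×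
  (∀ S → IsForcingSet G M S → k ≤ edgeCount S)

InSpectrum : ∀ {m} → SimpleGraph m → ℕ → Set
InSpectrum G k = ∃ λ M → IsPerfectMatching G M × ForcingNumber G M k

MaxForcingNumber : ∀ {m} → SimpleGraph m → ℕ → Set
MaxForcingNumber G k =
  InSpectrum G k × (∀ k' → InSpectrum G k' → k' ≤ k)

ContinuousSpectrum : ∀ {m} → SimpleGraph m → Set
ContinuousSpectrum G =
  ∀ a b k → InSpectrum G a → InSpectrum G b → a ≤ k → k ≤ b → InSpectrum G k

HasPerfectMatching : ∀ {m} → SimpleGraph m → Set
HasPerfectMatching G = ∃ λ M → IsPerfectMatching G M

-- Fix a perfect matching a with
-- f(G, a) = n − 1 = F(G). Deleting any two of its n edges leaves n − 2 edges, too few to force a,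
-- so another perfect matching agrees with a away from those four vertices: any two edges of a lie
-- on an a-alternating 4-cycle. Following the alternating cycle of a △ p, these 4-cycles allow one
-- or two twists (switches along alternating 4-cycles) of any perfect matching p ≠ a after which
-- it agrees with a at more vertices; hence p is joined to a by a path of twists. A twist raises
-- the forcing number by at most one: exchanging the two switched edges in a minimum forcing set S
-- yields a forcing set of the twisted matching, and S contains one of the switched edges. Along
-- the path from any M to a the forcing number therefore climbs from f(G, M) to F(G) without
-- skipping a value.
module Submission where

open import Data.Bool using (Bool; true; false; _∧_; _∨_; not; if_then_else_)
open import Data.Bool.Properties using (∧-zeroʳ; ∨-zeroʳ) renaming (_≟_ to _≟ᵇ_)
open import Data.Empty using (⊥-elim)
open import Data.Fin using (Fin; zero; suc; toℕ)
open import Data.Fin.Properties using (_≟_; toℕ-injective; all?; any?)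
open import Data.List using (map; allFin; tabulate)
open import Data.List.Properties using (map-tabulate)
open import Data.Nat using (ℕ; zero; suc; _+_; _*_; _∸_; _≤_; _<_; _<ᵇ_; z≤n; s≤s)
open import Data.Nat.Induction using (<-rec; <-wellFounded)
open import Data.Nat.ListAction using () renaming (sum to sumList)
open import Data.Nat.Properties renaming (_≟_ to _≟ℕ_)
open import Data.Product using (∃; _×_; _,_; proj₁; proj₂)
open import Data.Sum using (_⊎_; inj₁; inj₂; swap)
open import Data.Vec.Functional using (_∷_; head; tail)
open import Defs hiding (sym)
open import Function using (_∘_)
open import Function.Bundles using (mk⇔)
open import Induction.WellFounded using (Acc; acc)
open import Relation.Binary.Definitions using (_Respects_; tri<; tri≈; tri>)
open import Relation.Binary.PropositionalEquality
open import Relation.Nullary using (¬_; Dec; yes; no; does; _because_)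
open import Relation.Nullary.Decidable
  using (dec-true; dec-false; does-⇔; decidable-stable; ¬?; _×-dec_; _⊎-dec_; _→-dec_)
import Relation.Nullary.Decidable as Dec
open import Relation.Nullary.Negation using (contradiction)
open import Relation.Unary using (Decidable)

open import Algebra.Properties.CommutativeMonoid.Sum +-0-commutativeMonoid
  using (sum-syntax; sum-cong-≗; sum-replicate-zero; ∑-distrib-+; ∑-comm)

𝟙 : Bool → ℕ
𝟙 b = if b then 1 else 0

sumList-map-allFin : ∀ {k} (f : Fin k → ℕ) → sumList (map f (allFin k)) ≡ ∑[ i < k ] f i
sumList-map-allFin {k} f = trans (cong sumList (map-tabulate (λ i → i) f)) (go k f)
  where
  go : ∀ k (f : Fin k → ℕ) → sumList (tabulate f) ≡ ∑[ i < k ] f i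
  go zero    f = refl
  go (suc k) f = cong (f zero +_) (go k (f ∘ suc))

∑-mono-≤ : ∀ {k} {f g : Fin k → ℕ} → (∀ i → f i ≤ g i) → ∑[ i < k ] f i ≤ ∑[ i < k ] g i
∑-mono-≤ {zero}  f≤g = z≤n
∑-mono-≤ {suc k} f≤g = +-mono-≤ (f≤g zero) (∑-mono-≤ (f≤g ∘ suc))

∑-mono-< : ∀ {k} {f g : Fin k → ℕ} → (∀ i → f i ≤ g i) → ∀ v → f v < g v →
           ∑[ i < k ] f i < ∑[ i < k ] g i
∑-mono-< f≤g zero    fv<gv = +-mono-<-≤ fv<gv (∑-mono-≤ (f≤g ∘ suc))
∑-mono-< f≤g (suc v) fv<gv = +-mono-≤-< (f≤g zero) (∑-mono-< (f≤g ∘ suc) v fv<gv)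

∑-1 : ∀ k → ∑[ i < k ] 1 ≡ k
∑-1 zero    = refl
∑-1 (suc k) = cong suc (∑-1 k)

-- `does` rather than the strict ⌊_⌋, so that does (suc v ≟ suc j) computes to does (v ≟ j)
∑-indicator : ∀ {k} (v : Fin k) → ∑[ j < k ] 𝟙 (does (v ≟ j)) ≡ 1
∑-indicator {suc k} zero    = cong suc (sum-replicate-zero k)
∑-indicator {suc k} (suc v) = ∑-indicator v

<ᵇ-true : ∀ {a b} → a < b → (a <ᵇ b) ≡ true
<ᵇ-true {a} {b} = dec-true (_ because <ᵇ-reflects-< a b)

<ᵇ-false : ∀ {a b} → ¬ a < b → (a <ᵇ b) ≡ false
<ᵇ-false {a} {b} = dec-false (_ because <ᵇ-reflects-< a b)

does-true : ∀ {A : Set} (a? : Dec A) → does a? ≡ true → A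
does-true (yes a) _ = a

𝟙-∧-mono : ∀ c {s t} → (s ≡ true → t ≡ true) → 𝟙 (c ∧ s) ≤ 𝟙 (c ∧ t)
𝟙-∧-mono false           s⇒t = z≤n
𝟙-∧-mono true  {false}   s⇒t = z≤n
𝟙-∧-mono true  {true}    s⇒t rewrite s⇒t refl = ≤-refl

𝟙-∧-∨ : ∀ c s t → 𝟙 (c ∧ (s ∨ t)) ≤ 𝟙 (c ∧ s) + 𝟙 (c ∧ t)
𝟙-∧-∨ false s     t = z≤n
𝟙-∧-∨ true  true  t = s≤s z≤n
𝟙-∧-∨ true  false t = ≤-refl

𝟙-∧-split : ∀ c s t → 𝟙 (c ∧ s) ≡ 𝟙 (c ∧ (s ∧ not t)) + 𝟙 (c ∧ (s ∧ t))
𝟙-∧-split false s     t     = refl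
𝟙-∧-split true  false t     = refl
𝟙-∧-split true  true  false = refl
𝟙-∧-split true  true  true  = refl

𝟙-∧-false : ∀ c → 𝟙 (c ∧ false) ≡ 0
𝟙-∧-false false = refl
𝟙-∧-false true  = refl

true-ext : ∀ {a b} → (a ≡ true → b ≡ true) → (b ≡ true → a ≡ true) → a ≡ b
true-ext {true}  {true}  a⇒b b⇒a = refl
true-ext {true}  {false} a⇒b b⇒a = sym (a⇒b refl)
true-ext {false} {true}  a⇒b b⇒a = b⇒a refl
true-ext {false} {false} a⇒b b⇒a = refl

∨-true : ∀ {a b} → a ∨ b ≡ true → a ≡ true ⊎ b ≡ true
∨-true {true}  _  = inj₁ refl
∨-true {false} b  = inj₂ b

∧-not-true : ∀ {a b} → a ∧ not b ≡ true → a ≡ true × b ≡ false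
∧-not-true {true} {false} _ = refl , refl

∨-introˡ : ∀ {a b} → a ≡ true → a ∨ b ≡ true
∨-introˡ refl = refl

∨-introʳ : ∀ {a b} → b ≡ true → a ∨ b ≡ true
∨-introʳ {a} refl = ∨-zeroʳ a

∧-not-intro : ∀ {a b} → a ≡ true → b ≡ false → a ∧ not b ≡ true
∧-not-intro refl refl = refl

module _ {m : ℕ} where

  -- binding tighter than _⊆ₑ_ from Defs, which has the default precedence 20
  infixl 22 _∩ₑ_
  infixl 21 _∪ₑ_ _∖ₑ_
  infix  4 _≐_

  _∪ₑ_ _∩ₑ_ _∖ₑ_ : EdgeRel m → EdgeRel m → EdgeRel m
  (S ∪ₑ T) i j = S i j ∨ T i j
  (S ∩ₑ T) i j = S i j ∧ T i j
  (S ∖ₑ T) i j = S i j ∧ not (T i j)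

  _≐_ : EdgeRel m → EdgeRel m → Set
  S ≐ T = ∀ i j → S i j ≡ T i j

  ≐-sym : ∀ {S T : EdgeRel m} → S ≐ T → T ≐ S
  ≐-sym S≐T i j = sym (S≐T i j)

  IsEdge : Fin m → Fin m → Fin m → Fin m → Set
  IsEdge u v i j = (i ≡ u × j ≡ v) ⊎ (i ≡ v × j ≡ u)

  isEdge? : ∀ u v i j → Dec (IsEdge u v i j)
  isEdge? u v i j = (i ≟ u ×-dec j ≟ v) ⊎-dec (i ≟ v ×-dec j ≟ u)

  edge : Fin m → Fin m → EdgeRel m
  edge u v i j = does (isEdge? u v i j)

  edge-sound : ∀ u v {i j} → edge u v i j ≡ true → IsEdge u v i j
  edge-sound u v {i} {j} = does-true (isEdge? u v i j)

  edge-complete : ∀ u v {i j} → IsEdge u v i j → edge u v i j ≡ true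
  edge-complete u v {i} {j} = dec-true (isEdge? u v i j)

  edge-absent : ∀ u v {i j} → ¬ IsEdge u v i j → edge u v i j ≡ false
  edge-absent u v {i} {j} = dec-false (isEdge? u v i j)

  edge-false : ∀ (u v : Fin m) {i j} → edge u v i j ≡ false → ¬ IsEdge u v i j
  edge-false u v uvij≡false uvij = contradiction (trans (sym uvij≡false) (edge-complete u v uvij)) λ ()

  edge-symmetric : ∀ u v → SymmetricE (edge u v)
  edge-symmetric u v i j = does-⇔ (mk⇔ flip flip) (isEdge? u v i j) (isEdge? u v j i)
    where
    flip : ∀ {i j} → IsEdge u v i j → IsEdge u v j i
    flip (inj₁ (i≡u , j≡v)) = inj₂ (j≡v , i≡u)
    flip (inj₂ (i≡v , j≡u)) = inj₁ (j≡u , i≡v)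

  edge-comm : ∀ u v → edge u v ≐ edge v u
  edge-comm u v i j = does-⇔ (mk⇔ swap swap) (isEdge? u v i j) (isEdge? v u i j)

  ∪ₑ-symmetric : ∀ {S T : EdgeRel m} → SymmetricE S → SymmetricE T → SymmetricE (S ∪ₑ T)
  ∪ₑ-symmetric symS symT i j rewrite symS i j | symT i j = refl

  ∖ₑ-symmetric : ∀ {S T : EdgeRel m} → SymmetricE S → SymmetricE T → SymmetricE (S ∖ₑ T)
  ∖ₑ-symmetric symS symT i j rewrite symS i j | symT i j = refl

  ∖ₑ-⊆ : ∀ {S T : EdgeRel m} → S ∖ₑ T ⊆ₑ S
  ∖ₑ-⊆ i j = proj₁ ∘ ∧-not-true

  ∖ₑ-monoˡ : ∀ {S S′ T : EdgeRel m} → S ⊆ₑ S′ → S ∖ₑ T ⊆ₑ S′ ∖ₑ T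
  ∖ₑ-monoˡ S⊆S′ i j S∖Tij with ∧-not-true S∖Tij
  ... | Sij , Tij = ∧-not-intro (S⊆S′ i j Sij) Tij

  weight : EdgeRel m → Fin m → Fin m → ℕ
  weight S i j = 𝟙 ((toℕ i <ᵇ toℕ j) ∧ S i j)

  edgeCount-∑ : ∀ S → edgeCount S ≡ ∑[ i < m ] ∑[ j < m ] weight S i j
  edgeCount-∑ S = trans (sumList-map-allFin (λ i → sumList (map (weight S i) (allFin m))))
                        (sum-cong-≗ (λ i → sumList-map-allFin (weight S i)))

  ∑∑-mono-≤ : {f g : Fin m → Fin m → ℕ} → (∀ i j → f i j ≤ g i j) →
              ∑[ i < m ] ∑[ j < m ] f i j ≤ ∑[ i < m ] ∑[ j < m ] g i j
  ∑∑-mono-≤ f≤g = ∑-mono-≤ (λ i → ∑-mono-≤ (f≤g i))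

  ∑∑-distrib-+ : (f g : Fin m → Fin m → ℕ) →
                 ∑[ i < m ] ∑[ j < m ] (f i j + g i j) ≡ ∑[ i < m ] ∑[ j < m ] f i j + ∑[ i < m ] ∑[ j < m ] g i j
  ∑∑-distrib-+ f g = trans (sum-cong-≗ (λ i → ∑-distrib-+ (f i) (g i)))
                           (∑-distrib-+ (λ i → ∑[ j < m ] f i j) (λ i → ∑[ j < m ] g i j))

  edgeCount-mono : ∀ {S T} → S ⊆ₑ T → edgeCount S ≤ edgeCount T
  edgeCount-mono {S} {T} S⊆T rewrite edgeCount-∑ S | edgeCount-∑ T =
    ∑∑-mono-≤ (λ i j → 𝟙-∧-mono _ (S⊆T i j))

  edgeCount-cong : ∀ {S T} → S ≐ T → edgeCount S ≡ edgeCount T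
  edgeCount-cong S≐T = ≤-antisym (edgeCount-mono (λ i j → trans (sym (S≐T i j))))
                                 (edgeCount-mono (λ i j → trans (S≐T i j)))

  edgeCount-∪ : ∀ S T → edgeCount (S ∪ₑ T) ≤ edgeCount S + edgeCount T
  edgeCount-∪ S T rewrite edgeCount-∑ (S ∪ₑ T) | edgeCount-∑ S | edgeCount-∑ T =
    ≤-trans (∑∑-mono-≤ (λ i j → 𝟙-∧-∨ _ (S i j) (T i j))) (≤-reflexive (∑∑-distrib-+ _ _))

  edgeCount-split : ∀ S T → edgeCount S ≡ edgeCount (S ∖ₑ T) + edgeCount (S ∩ₑ T)
  edgeCount-split S T rewrite edgeCount-∑ S | edgeCount-∑ (S ∖ₑ T) | edgeCount-∑ (S ∩ₑ T) =
    trans (sum-cong-≗ (λ i → sum-cong-≗ (λ j → 𝟙-∧-split _ (S i j) (T i j)))) (∑∑-distrib-+ _ _)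

  private
    weight-edge-at-u : ∀ {u v} → toℕ u < toℕ v → ∀ j → weight (edge u v) u j ≡ 𝟙 (does (v ≟ j))
    weight-edge-at-u {u} {v} u<v j with v ≟ j
    ... | yes refl rewrite <ᵇ-true u<v | edge-complete u v {u} {v} (inj₁ (refl , refl)) = refl
    ... | no v≢j rewrite edge-absent u v {u} {j} λ where
            (inj₁ (_ , j≡v)) → v≢j (sym j≡v)
            (inj₂ (u≡v , _)) → <-irrefl (cong toℕ u≡v) u<v
          = 𝟙-∧-false _

    weight-edge-off-u : ∀ {u v i} → toℕ u < toℕ v → u ≢ i → ∀ j → 𝟙 ((toℕ i <ᵇ toℕ j) ∧ edge u v i j) ≡ 0
    weight-edge-off-u {u} {v} {i} u<v u≢i j with edge u v i j in e
    ... | false = 𝟙-∧-false _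
    ... | true with edge-sound u v {i} {j} e
    ...   | inj₁ (i≡u , _)   = ⊥-elim (u≢i (sym i≡u))
    ...   | inj₂ (refl , refl) rewrite <ᵇ-false (<⇒≯ u<v) = refl

    edgeCount-ordered-edge : ∀ {u v} → toℕ u < toℕ v → edgeCount (edge u v) ≡ 1
    edgeCount-ordered-edge {u} {v} u<v = trans (edgeCount-∑ (edge u v)) (trans (sum-cong-≗ row) (∑-indicator u))
      where
      row : ∀ i → ∑[ j < m ] weight (edge u v) i j ≡ 𝟙 (does (u ≟ i))
      row i with u ≟ i
      ... | yes refl = trans (sum-cong-≗ (weight-edge-at-u u<v)) (∑-indicator v)
      ... | no u≢i   = trans (sum-cong-≗ (weight-edge-off-u u<v u≢i)) (sum-replicate-zero m)

  edgeCount-edge : ∀ {u v} → u ≢ v → edgeCount (edge u v) ≡ 1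
  edgeCount-edge {u} {v} u≢v with <-cmp (toℕ u) (toℕ v)
  ... | tri< u<v _ _ = edgeCount-ordered-edge u<v
  ... | tri≈ _ u≡v _ = ⊥-elim (u≢v (toℕ-injective u≡v))
  ... | tri> _ _ v<u = trans (edgeCount-cong (edge-comm u v)) (edgeCount-ordered-edge v<u)

  edgeCount-∖edge : ∀ {S u v} → SymmetricE S → u ≢ v → S u v ≡ true →
                    edgeCount S ≡ suc (edgeCount (S ∖ₑ edge u v))
  edgeCount-∖edge {S} {u} {v} symS u≢v Suv = begin
    edgeCount S                                ≡⟨ edgeCount-split S (edge u v) ⟩
    edgeCount (S ∖ₑ e) + edgeCount (S ∩ₑ e)     ≡⟨ cong (edgeCount (S ∖ₑ e) +_) (edgeCount-cong S∩e≐e) ⟩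
    edgeCount (S ∖ₑ e) + edgeCount e            ≡⟨ cong (edgeCount (S ∖ₑ e) +_) (edgeCount-edge u≢v) ⟩
    edgeCount (S ∖ₑ e) + 1                      ≡⟨ +-comm _ 1 ⟩
    suc (edgeCount (S ∖ₑ e))                    ∎
    where
    e = edge u v
    open ≡-Reasoning
    S∩e≐e : ∀ i j → S i j ∧ edge u v i j ≡ edge u v i j
    S∩e≐e i j with edge u v i j in uvij
    ... | false = ∧-zeroʳ (S i j)
    ... | true with edge-sound u v {i} {j} uvij
    ...   | inj₁ (refl , refl) rewrite Suv = refl
    ...   | inj₂ (refl , refl) rewrite symS v u | Suv = refl

  degreeSum : EdgeRel m → ℕ
  degreeSum S = ∑[ i < m ] ∑[ j < m ] 𝟙 (S i j)

  degreeSum≡2*edgeCount : ∀ {S} → SymmetricE S → (∀ i → S i i ≡ false) → degreeSum S ≡ 2 * edgeCount S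
  degreeSum≡2*edgeCount {S} symS irrS = begin
    degreeSum S                                                  ≡⟨ sum-cong-≗ (λ i → sum-cong-≗ (both-orders i)) ⟩
    ∑[ i < m ] ∑[ j < m ] (weight S i j + weight S j i)          ≡⟨ ∑∑-distrib-+ (weight S) (λ i j → weight S j i) ⟩
    E + ∑[ i < m ] ∑[ j < m ] weight S j i                       ≡⟨ cong (E +_) (∑-comm (λ i j → weight S j i)) ⟩
    E + E                                                        ≡⟨ cong (E +_) (sym (+-identityʳ E)) ⟩
    2 * E                                                        ≡⟨ cong (2 *_) (sym (edgeCount-∑ S)) ⟩
    2 * edgeCount S                                              ∎
    where
    open ≡-Reasoning
    E = ∑[ i < m ] ∑[ j < m ] weight S i j
    both-orders : ∀ i j → 𝟙 (S i j) ≡ weight S i j + weight S j i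
    both-orders i j with <-cmp (toℕ i) (toℕ j)
    ... | tri< i<j _ _ rewrite <ᵇ-true i<j | <ᵇ-false (<⇒≯ i<j) = sym (+-identityʳ _)
    ... | tri> _ _ j<i rewrite <ᵇ-false (<⇒≯ j<i) | <ᵇ-true j<i | symS j i = refl
    ... | tri≈ _ i≡j _ with refl ← toℕ-injective {i = i} {j} i≡j rewrite irrS i =
      sym (cong₂ _+_ (𝟙-∧-false (toℕ i <ᵇ toℕ i)) (𝟙-∧-false (toℕ i <ᵇ toℕ i)))

edgesOf : ∀ {m} → (Fin m → Fin m) → EdgeRel m
edgesOf p i j = does (p i ≟ j)

module _ {m : ℕ} where

  edgesOf-sound : ∀ (p : Fin m → Fin m) {i j} → edgesOf p i j ≡ true → p i ≡ j
  edgesOf-sound p {i} {j} = does-true (p i ≟ j)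

  edgesOf-complete : ∀ (p : Fin m → Fin m) {i j} → p i ≡ j → edgesOf p i j ≡ true
  edgesOf-complete p {i} {j} = dec-true (p i ≟ j)

  edgesOf-absent : ∀ (p : Fin m → Fin m) {i j} → p i ≢ j → edgesOf p i j ≡ false
  edgesOf-absent p {i} {j} = dec-false (p i ≟ j)

  edgesOf-cong : ∀ {p q : Fin m → Fin m} → p ≗ q → edgesOf p ≐ edgesOf q
  edgesOf-cong p≗q i j rewrite p≗q i = refl

  edgesOf-injective : ∀ {p q : Fin m → Fin m} → edgesOf p ≐ edgesOf q → p ≗ q
  edgesOf-injective {p} {q} eq z = sym (edgesOf-sound q (trans (sym (eq z (p z))) (edgesOf-complete p refl)))

  degreeSum-edgesOf : (p : Fin m → Fin m) → degreeSum (edgesOf p) ≡ m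
  degreeSum-edgesOf p = trans (sum-cong-≗ (λ i → ∑-indicator (p i))) (∑-1 m)

module _ {m : ℕ} (G : SimpleGraph m) where

  -- A perfect matching of G, represented by its mate function: its edges are the pairs {z , p z}.
  record IsMate (p : Fin m → Fin m) : Set where
    field
      involutive    : ∀ z → p (p z) ≡ z
      fixpoint-free : ∀ z → p z ≢ z
      adjacent      : ∀ z → adj G z (p z) ≡ true

    injective : ∀ {a b} → p a ≡ p b → a ≡ b
    injective {a} {b} pa≡pb = trans (sym (involutive a)) (trans (cong p pa≡pb) (involutive b))

    edgesOf-symmetric : SymmetricE (edgesOf p)
    edgesOf-symmetric i j = does-⇔ (mk⇔ flip flip) (p i ≟ j) (p j ≟ i)
      where
      flip : ∀ {i j} → p i ≡ j → p j ≡ i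
      flip {i} refl = involutive i

    edgesOf-irreflexive : ∀ i → edgesOf p i i ≡ false
    edgesOf-irreflexive i = edgesOf-absent p (fixpoint-free i)

  open IsMate public

  isPerfectMatching-edgesOf : ∀ {p} → IsMate p → IsPerfectMatching G (edgesOf p)
  isPerfectMatching-edgesOf {p} P =
    edgesOf-symmetric P , in-G , λ i → p i , edgesOf-complete p refl , λ k e → sym (edgesOf-sound p e)
    where
    in-G : edgesOf p ⊆ₑ adj G
    in-G i j e = subst (λ k → adj G i k ≡ true) (edgesOf-sound p e) (adjacent P i)

  mateOf : ∀ {M} → IsPerfectMatching G M → ∃ λ p → IsMate p × M ≐ edgesOf p
  mateOf {M} (symM , M⊆G , unique) = p , P , M≐p
    where
    p : Fin m → Fin m
    p i = proj₁ (unique i)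
    M-p : ∀ i → M i (p i) ≡ true
    M-p i = proj₁ (proj₂ (unique i))
    M-only-p : ∀ {i j} → M i j ≡ true → j ≡ p i
    M-only-p {i} {j} = proj₂ (proj₂ (unique i)) j
    P : IsMate p
    P = record
      { involutive    = λ z → sym (M-only-p (trans (symM (p z) z) (M-p z)))
      ; fixpoint-free = λ z pz≡z → contradiction (M⊆G z z (subst (λ k → M z k ≡ true) pz≡z (M-p z)))
                                                 (λ e → contradiction (trans (sym (irrefl G z)) e) λ ())
      ; adjacent      = λ z → M⊆G z (p z) (M-p z)
      }
    M≐p : M ≐ edgesOf p
    M≐p i j = true-ext (λ Mij → edgesOf-complete p (sym (M-only-p Mij)))
                       (λ pij → subst (λ k → M i k ≡ true) (edgesOf-sound p pij) (M-p i))

  edgeCount-mate : ∀ {p} → IsMate p → 2 * edgeCount (edgesOf p) ≡ m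
  edgeCount-mate {p} P =
    trans (sym (degreeSum≡2*edgeCount (edgesOf-symmetric P) (edgesOf-irreflexive P))) (degreeSum-edgesOf p)

module _ {m : ℕ} where

  -- Switching p along the 4-cycle x – y – p y – p x: the edges {x , p x} and {y , p y}
  -- are replaced by {x , y} and {p x , p y}.
  twist : (Fin m → Fin m) → Fin m → Fin m → Fin m → Fin m
  twist p x y z =
    if does (z ≟ x) then y else if does (z ≟ y) then x else
    if does (z ≟ p x) then p y else if does (z ≟ p y) then p x else p z

  data Location (p : Fin m → Fin m) (x y z : Fin m) : Set where
    at-x  : z ≡ x → Location p x y z
    at-y  : z ≡ y → Location p x y z
    at-px : z ≡ p x → Location p x y z
    at-py : z ≡ p y → Location p x y z
    away  : z ≢ x → z ≢ y → z ≢ p x → z ≢ p y → Location p x y z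

  locate : ∀ p x y z → Location p x y z
  locate p x y z with z ≟ x | z ≟ y | z ≟ p x | z ≟ p y
  ... | yes z≡x | _       | _        | _        = at-x z≡x
  ... | no _    | yes z≡y | _        | _        = at-y z≡y
  ... | no _    | no _    | yes z≡px | _        = at-px z≡px
  ... | no _    | no _    | no _     | yes z≡py = at-py z≡py
  ... | no z≢x  | no z≢y  | no z≢px  | no z≢py  = away z≢x z≢y z≢px z≢py

  module _ (p : Fin m → Fin m) (x y : Fin m) where

    twist-x : twist p x y x ≡ y
    twist-x rewrite dec-true (x ≟ x) refl = refl

    twist-y : y ≢ x → twist p x y y ≡ x
    twist-y y≢x rewrite dec-false (y ≟ x) y≢x | dec-true (y ≟ y) refl = refl

    twist-px : p x ≢ x → p x ≢ y → twist p x y (p x) ≡ p y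
    twist-px px≢x px≢y
      rewrite dec-false (p x ≟ x) px≢x | dec-false (p x ≟ y) px≢y | dec-true (p x ≟ p x) refl = refl

    twist-py : p y ≢ x → p y ≢ y → p y ≢ p x → twist p x y (p y) ≡ p x
    twist-py py≢x py≢y py≢px
      rewrite dec-false (p y ≟ x) py≢x | dec-false (p y ≟ y) py≢y | dec-false (p y ≟ p x) py≢px
            | dec-true (p y ≟ p y) refl = refl

    twist-away : ∀ {z} → z ≢ x → z ≢ y → z ≢ p x → z ≢ p y → twist p x y z ≡ p z
    twist-away {z} z≢x z≢y z≢px z≢py
      rewrite dec-false (z ≟ x) z≢x | dec-false (z ≟ y) z≢y | dec-false (z ≟ p x) z≢px
            | dec-false (z ≟ p y) z≢py = refl

module _ {m : ℕ} (G : SimpleGraph m) where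

  -- x – y – p y – p x is a 4-cycle of G alternating with respect to p
  record Twistable (p : Fin m → Fin m) (x y : Fin m) : Set where
    field
      y≢x        : y ≢ x
      y≢px       : y ≢ p x
      adj-x-y    : adj G x y ≡ true
      adj-px-py  : adj G (p x) (p y) ≡ true

  open Twistable public

  module Twist {p : Fin m → Fin m} (P : IsMate G p) {x y : Fin m} (C : Twistable p x y) where

    px≢x : p x ≢ x
    px≢x = fixpoint-free P x

    py≢y : p y ≢ y
    py≢y = fixpoint-free P y

    px≢y : p x ≢ y
    px≢y = y≢px C ∘ sym

    py≢x : p y ≢ x
    py≢x py≡x = y≢px C (trans (sym (involutive P y)) (cong p py≡x))

    py≢px : p y ≢ p x
    py≢px = y≢x C ∘ injective P

    q : Fin m → Fin m
    q = twist p x y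

    q-x : q x ≡ y
    q-x = twist-x p x y

    q-y : q y ≡ x
    q-y = twist-y p x y (y≢x C)

    q-px : q (p x) ≡ p y
    q-px = twist-px p x y px≢x px≢y

    q-py : q (p y) ≡ p x
    q-py = twist-py p x y py≢x py≢y py≢px

    q-away : ∀ {z} → z ≢ x → z ≢ y → z ≢ p x → z ≢ p y → q z ≡ p z
    q-away = twist-away p x y

    p-away : ∀ {z} → z ≢ x → z ≢ y → z ≢ p x → z ≢ p y →
             p z ≢ x × p z ≢ y × p z ≢ p x × p z ≢ p y
    p-away {z} z≢x z≢y z≢px z≢py =
      (λ pz≡x → z≢px (trans (sym (involutive P z)) (cong p pz≡x))) ,
      (λ pz≡y → z≢py (trans (sym (involutive P z)) (cong p pz≡y))) ,
      z≢x ∘ injective P ,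
      z≢y ∘ injective P

    isMate : IsMate G q
    isMate = record { involutive = invol ; fixpoint-free = no-fix ; adjacent = adjacent-q }
      where
      invol : ∀ z → q (q z) ≡ z
      invol z with locate p x y z
      ... | at-x  refl = trans (cong q q-x) q-y
      ... | at-y  refl = trans (cong q q-y) q-x
      ... | at-px refl = trans (cong q q-px) q-py
      ... | at-py refl = trans (cong q q-py) q-px
      ... | away z≢x z≢y z≢px z≢py with p-away z≢x z≢y z≢px z≢py
      ...   | pz≢x , pz≢y , pz≢px , pz≢py =
        trans (cong q (q-away z≢x z≢y z≢px z≢py)) (trans (q-away pz≢x pz≢y pz≢px pz≢py) (involutive P z))
      no-fix : ∀ z → q z ≢ z
      no-fix z with locate p x y z
      ... | at-x  refl = λ e → y≢x C (trans (sym q-x) e)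
      ... | at-y  refl = λ e → y≢x C (sym (trans (sym q-y) e))
      ... | at-px refl = λ e → py≢px (trans (sym q-px) e)
      ... | at-py refl = λ e → py≢px (sym (trans (sym q-py) e))
      ... | away z≢x z≢y z≢px z≢py = λ e → fixpoint-free P z (trans (sym (q-away z≢x z≢y z≢px z≢py)) e)
      adjacent-q : ∀ z → adj G z (q z) ≡ true
      adjacent-q z with locate p x y z
      ... | at-x  refl rewrite q-x = adj-x-y C
      ... | at-y  refl rewrite q-y = trans (SimpleGraph.sym G y x) (adj-x-y C)
      ... | at-px refl rewrite q-px = adj-px-py C
      ... | at-py refl rewrite q-py = trans (SimpleGraph.sym G (p y) (p x)) (adj-px-py C)
      ... | away z≢x z≢y z≢px z≢py rewrite q-away z≢x z≢y z≢px z≢py = adjacent P z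

least : ∀ {Q : ℕ → Set} → Decidable Q → ∀ {N} → Q N → ∃ λ k → Q k × (∀ {k′} → Q k′ → k ≤ k′)
least {Q} Q? {N} = <-rec (λ N → Q N → ∃ λ k → Q k × (∀ {k′} → Q k′ → k ≤ k′)) go N
  where
  go : ∀ N → (∀ {M} → M < N → Q M → ∃ λ k → Q k × (∀ {k′} → Q k′ → k ≤ k′)) →
       Q N → ∃ λ k → Q k × (∀ {k′} → Q k′ → k ≤ k′)
  go N smaller QN with anyUpTo? Q? N
  ... | yes (M , M<N , QM) = smaller M<N QM
  ... | no none            = N , QN , λ {k′} Qk′ → ≮⇒≥ (λ k′<N → none (k′ , k′<N , Qk′))

-- Exhaustive search. Predicates on edge relations must respect pointwise equality ≈,
-- as pointwise equal functions need not be equal.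
Searchable : (A : Set) → (A → A → Set) → Set₁
Searchable A _≈_ = ∀ {P : A → Set} → P Respects _≈_ → Decidable P → Dec (∃ P)

searchable-Bool : Searchable Bool _≡_
searchable-Bool {P} _ P? with P? true | P? false
... | yes Pt  | _        = yes (true , Pt)
... | no _    | yes Pf   = yes (false , Pf)
... | no ¬Pt  | no ¬Pf   = no λ { (true , Pt) → ¬Pt Pt ; (false , Pf) → ¬Pf Pf }

searchable-Π : ∀ {A : Set} {_≈_ : A → A → Set} → (∀ {a} → a ≈ a) → Searchable A _≈_ →
               ∀ k → Searchable (Fin k → A) (λ f g → ∀ i → f i ≈ g i)
searchable-Π ≈-refl search zero    {P} resp P? =
  Dec.map′ (λ P[] → [] , P[]) (λ (f , Pf) → resp (λ ()) Pf) (P? [])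
  where
  [] : Fin 0 → _
  [] ()
searchable-Π ≈-refl search (suc k) {P} resp P? =
  Dec.map′ (λ (a , f , Pa∷f) → (a ∷ f) , Pa∷f)
           (λ (f , Pf) → head f , tail f , resp (λ { zero → ≈-refl ; (suc i) → ≈-refl }) Pf)
           (search (λ a≈b (f , Pa∷f) → f , resp (λ { zero → a≈b ; (suc i) → ≈-refl }) Pa∷f) extends?)
  where
  extends? : ∀ a → Dec (∃ λ f → P (a ∷ f))
  extends? a = searchable-Π ≈-refl search k (λ f≈g → resp (λ { zero → ≈-refl ; (suc i) → f≈g i }))
                                             (λ f → P? (a ∷ f))

search-∀ : ∀ {A : Set} {_≈_ : A → A → Set} → (∀ {a b} → a ≈ b → b ≈ a) → Searchable A _≈_ →
           ∀ {P : A → Set} → P Respects _≈_ → Decidable P → Dec (∀ a → P a)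
search-∀ ≈-sym search {P} resp P? with search (λ a≈b ¬Pa Pb → ¬Pa (resp (≈-sym a≈b) Pb)) (¬? ∘ P?)
... | yes (a , ¬Pa) = no λ ∀P → ¬Pa (∀P a)
... | no ∄¬P        = yes λ a → decidable-stable (P? a) (λ ¬Pa → ∄¬P (a , ¬Pa))

module _ {m : ℕ} where

  searchable-EdgeRel : Searchable (EdgeRel m) _≐_
  searchable-EdgeRel = searchable-Π (λ _ → refl) (searchable-Π refl searchable-Bool m) m

  _≐?_ : ∀ (S T : EdgeRel m) → Dec (S ≐ T)
  S ≐? T = all? λ i → all? λ j → S i j ≟ᵇ T i j

  _⊆ₑ?_ : ∀ (S T : EdgeRel m) → Dec (S ⊆ₑ T)
  S ⊆ₑ? T = all? λ i → all? λ j → (S i j ≟ᵇ true) →-dec (T i j ≟ᵇ true)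

module _ {m : ℕ} (G : SimpleGraph m) where

  isPerfectMatching-cong : IsPerfectMatching G Respects _≐_
  isPerfectMatching-cong M≐M′ (symM , M⊆G , unique) =
    (λ i j → trans (sym (M≐M′ i j)) (trans (symM i j) (M≐M′ j i))) ,
    (λ i j M′ij → M⊆G i j (trans (M≐M′ i j) M′ij)) ,
    (λ i → proj₁ (unique i) , trans (sym (M≐M′ i _)) (proj₁ (proj₂ (unique i))) ,
           λ k M′ik → proj₂ (proj₂ (unique i)) k (trans (M≐M′ i k) M′ik))

  isPerfectMatching? : Decidable (IsPerfectMatching G)
  isPerfectMatching? M =
    (all? λ i → all? λ j → M i j ≟ᵇ M j i) ×-dec
    (M ⊆ₑ? adj G) ×-dec
    (all? λ i → any? λ j → (M i j ≟ᵇ true) ×-dec (all? λ k → (M i k ≟ᵇ true) →-dec (k ≟ j)))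

  isForcingSet-cong-set : ∀ {M} → IsForcingSet G M Respects _≐_
  isForcingSet-cong-set S≐S′ (symS , S⊆M , forces) =
    (λ i j → trans (sym (S≐S′ i j)) (trans (symS i j) (S≐S′ j i))) ,
    (λ i j S′ij → S⊆M i j (trans (S≐S′ i j) S′ij)) ,
    (λ M′ pm S′⊆M′ → forces M′ pm (λ i j Sij → S′⊆M′ i j (trans (sym (S≐S′ i j)) Sij)))

  isForcingSet-cong-matching : ∀ {M M′ S} → M ≐ M′ → IsForcingSet G M S → IsForcingSet G M′ S
  isForcingSet-cong-matching M≐M′ (symS , S⊆M , forces) =
    symS , (λ i j Sij → trans (sym (M≐M′ i j)) (S⊆M i j Sij)) ,
    (λ M″ pm S⊆M″ i j → trans (forces M″ pm S⊆M″ i j) (M≐M′ i j))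

  isForcingSet? : ∀ M → Decidable (IsForcingSet G M)
  isForcingSet? M S =
    (all? λ i → all? λ j → S i j ≟ᵇ S j i) ×-dec
    (S ⊆ₑ? M) ×-dec
    search-∀ ≐-sym searchable-EdgeRel forces-cong
             (λ M′ → isPerfectMatching? M′ →-dec (S ⊆ₑ? M′) →-dec (M′ ≐? M))
    where
    forces-cong : (λ M′ → IsPerfectMatching G M′ → S ⊆ₑ M′ → M′ ≐ M) Respects _≐_
    forces-cong M′≐M″ forces pm S⊆M″ i j =
      trans (sym (M′≐M″ i j))
            (forces (isPerfectMatching-cong (≐-sym M′≐M″) pm) (λ a b Sab → trans (M′≐M″ a b) (S⊆M″ a b Sab)) i j)

  isForcingSet-self : ∀ {M} → IsPerfectMatching G M → IsForcingSet G M M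
  isForcingSet-self {M} (symM , _ , uniqueM) = symM , (λ _ _ Mij → Mij) , forces
    where
    forces : ∀ M′ → IsPerfectMatching G M′ → M ⊆ₑ M′ → M′ ≐ M
    forces M′ (_ , _ , uniqueM′) M⊆M′ i j = true-ext M′→M (M⊆M′ i j)
      where
      M′→M : M′ i j ≡ true → M i j ≡ true
      M′→M M′ij with uniqueM i | uniqueM′ i
      ... | k , Mik , _ | _ , _ , only′ =
        subst (λ l → M i l ≡ true) (trans (only′ k (M⊆M′ i k Mik)) (sym (only′ j M′ij))) Mik

  forcingNumber-cong : ∀ {M M′ k} → M ≐ M′ → ForcingNumber G M k → ForcingNumber G M′ k
  forcingNumber-cong M≐M′ ((S , F , |S|≡k) , minimal) =
    (S , isForcingSet-cong-matching M≐M′ F , |S|≡k) ,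
    (λ S′ F′ → minimal S′ (isForcingSet-cong-matching (≐-sym M≐M′) F′))

  forcingNumber-unique : ∀ {M k l} → ForcingNumber G M k → ForcingNumber G M l → k ≡ l
  forcingNumber-unique ((S , F , |S|≡k) , minimalₖ) ((T , F′ , |T|≡l) , minimalₗ) =
    ≤-antisym (subst (_ ≤_) |T|≡l (minimalₖ T F′)) (subst (_ ≤_) |S|≡k (minimalₗ S F))

  forcingNumber-exists : ∀ {M} → IsPerfectMatching G M → ∃ (ForcingNumber G M)
  forcingNumber-exists {M} pm = minimum (least forcingSetOfSize? (M , isForcingSet-self pm , refl))
    where
    ForcingSetOfSize : ℕ → Set
    ForcingSetOfSize k = ∃ λ S → IsForcingSet G M S × edgeCount S ≡ k
    forcingSetOfSize? : Decidable ForcingSetOfSize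
    forcingSetOfSize? k =
      searchable-EdgeRel
        (λ S≐S′ (F , |S|≡k) → isForcingSet-cong-set S≐S′ F , trans (sym (edgeCount-cong S≐S′)) |S|≡k)
                         (λ S → isForcingSet? M S ×-dec (edgeCount S ≟ℕ k))
    minimum : (∃ λ k → ForcingSetOfSize k × ∀ {k′} → ForcingSetOfSize k′ → k ≤ k′) → ∃ (ForcingNumber G M)
    minimum (k , has-k , minimal) = k , has-k , λ S F → minimal (S , F , refl)

  forcingSet-forces-mate : ∀ {p r S} → IsForcingSet G (edgesOf p) S → IsMate G r → S ⊆ₑ edgesOf r → r ≗ p
  forcingSet-forces-mate (_ , _ , forces) R S⊆r = edgesOf-injective (forces _ (isPerfectMatching-edgesOf G R) S⊆r)

  rival-of-¬forcing : ∀ {M S} → ¬ IsForcingSet G M S → SymmetricE S → S ⊆ₑ M →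
                      ∃ λ M′ → IsPerfectMatching G M′ × S ⊆ₑ M′ × ¬ M′ ≐ M
  rival-of-¬forcing {M} {S} ¬F symS S⊆M
    with searchable-EdgeRel rival-cong (λ M′ → isPerfectMatching? M′ ×-dec (S ⊆ₑ? M′) ×-dec ¬? (M′ ≐? M))
    where
    rival-cong : (λ M′ → IsPerfectMatching G M′ × S ⊆ₑ M′ × ¬ M′ ≐ M) Respects _≐_
    rival-cong M′≐M″ (pm , S⊆M′ , M′≉M) =
      isPerfectMatching-cong M′≐M″ pm ,
      (λ i j Sij → trans (sym (M′≐M″ i j)) (S⊆M′ i j Sij)) ,
      (λ M″≐M → M′≉M (λ i j → trans (M′≐M″ i j) (M″≐M i j)))
  ... | yes rival = rival
  ... | no ∄rival = ⊥-elim (¬F (symS , S⊆M , forces))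
    where
    forces : ∀ M′ → IsPerfectMatching G M′ → S ⊆ₑ M′ → M′ ≐ M
    forces M′ pm S⊆M′ = decidable-stable (M′ ≐? M) (λ M′≉M → ∄rival (M′ , pm , S⊆M′ , M′≉M))

module TwistForcing {m : ℕ} (G : SimpleGraph m) {p : Fin m → Fin m} (P : IsMate G p)
                    {x y : Fin m} (C : Twistable G p x y) {S : EdgeRel m}
                    (F : IsForcingSet G (edgesOf p) S) where

  open Twist G P C

  private
    S-in-p : ∀ {i j} → S i j ≡ true → p i ≡ j
    S-in-p {i} {j} Sij = edgesOf-sound p (proj₁ (proj₂ F) i j Sij)

  kept : EdgeRel m
  kept = S ∖ₑ edge x (p x) ∖ₑ edge y (p y)

  S′ : EdgeRel m
  S′ = kept ∪ₑ edge x y ∪ₑ edge (p x) (p y)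

  data S′-Edge (i j : Fin m) : Set where
    new-x-y   : IsEdge x y i j → S′-Edge i j
    new-px-py : IsEdge (p x) (p y) i j → S′-Edge i j
    old       : S i j ≡ true → i ≢ x → i ≢ y → i ≢ p x → i ≢ p y → S′-Edge i j

  S′-sound : ∀ {i j} → S′ i j ≡ true → S′-Edge i j
  S′-sound {i} {j} S′ij with ∨-true S′ij
  ... | inj₂ e₄ = new-px-py (edge-sound (p x) (p y) e₄)
  ... | inj₁ S′ij′ with ∨-true S′ij′
  ...   | inj₂ e₃ = new-x-y (edge-sound x y e₃)
  ...   | inj₁ keptij with ∧-not-true keptij
  ...     | S∖e₁ij , e₂ij with ∧-not-true S∖e₁ij
  ...       | Sij , e₁ij = old Sij
      (λ i≡x  → edge-false x (p x) e₁ij (inj₁ (i≡x , j≡p i≡x)))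
      (λ i≡y  → edge-false y (p y) e₂ij (inj₁ (i≡y , j≡p i≡y)))
      (λ i≡px → edge-false x (p x) e₁ij (inj₂ (i≡px , trans (j≡p i≡px) (involutive P x))))
      (λ i≡py → edge-false y (p y) e₂ij (inj₂ (i≡py , trans (j≡p i≡py) (involutive P y))))
    where
    j≡p : ∀ {z} → i ≡ z → j ≡ p z
    j≡p refl = sym (S-in-p Sij)

  S′-complete : ∀ {i j} → S′-Edge i j → S′ i j ≡ true
  S′-complete {i} {j} (new-x-y e) =
    ∨-introˡ {b = edge (p x) (p y) i j} (∨-introʳ {a = kept i j} (edge-complete x y e))
  S′-complete {i} {j} (new-px-py e) = ∨-introʳ {a = kept i j ∨ edge x y i j} (edge-complete (p x) (p y) e)
  S′-complete {i} {j} (old Sij i≢x i≢y i≢px i≢py) =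
    ∨-introˡ (∨-introˡ (∧-not-intro (∧-not-intro Sij e₁ij) e₂ij))
    where
    e₁ij : edge x (p x) i j ≡ false
    e₁ij = edge-absent x (p x) {i} {j} λ { (inj₁ (i≡x , _)) → i≢x i≡x ; (inj₂ (i≡px , _)) → i≢px i≡px }
    e₂ij : edge y (p y) i j ≡ false
    e₂ij = edge-absent y (p y) {i} {j} λ { (inj₁ (i≡y , _)) → i≢y i≡y ; (inj₂ (i≡py , _)) → i≢py i≡py }

  S′-symmetric : SymmetricE S′
  S′-symmetric = ∪ₑ-symmetric (∪ₑ-symmetric (∖ₑ-symmetric (∖ₑ-symmetric (proj₁ F) (edge-symmetric x (p x)))
                                                           (edge-symmetric y (p y)))
                                             (edge-symmetric x y))
                              (edge-symmetric (p x) (p y))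

  S′⊆q : S′ ⊆ₑ edgesOf q
  S′⊆q i j S′ij = edgesOf-complete q {i} (in-q (S′-sound S′ij))
    where
    in-q : S′-Edge i j → q i ≡ j
    in-q (new-x-y (inj₁ (refl , refl)))   = q-x
    in-q (new-x-y (inj₂ (refl , refl)))   = q-y
    in-q (new-px-py (inj₁ (refl , refl))) = q-px
    in-q (new-px-py (inj₂ (refl , refl))) = q-py
    in-q (old Sij i≢x i≢y i≢px i≢py)      = trans (q-away i≢x i≢y i≢px i≢py) (S-in-p Sij)

  -- Twisting a mate r ⊇ S′ back along x – p x gives a mate containing S, which must therefore be p.
  module Back {r : Fin m → Fin m} (R : IsMate G r) (S′⊆r : S′ ⊆ₑ edgesOf r) where

    in-r : ∀ {i j} → S′ i j ≡ true → r i ≡ j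
    in-r {i} {j} S′ij = edgesOf-sound r (S′⊆r i j S′ij)

    r-x : r x ≡ y
    r-x = in-r (S′-complete (new-x-y (inj₁ (refl , refl))))

    r-px : r (p x) ≡ p y
    r-px = in-r (S′-complete (new-px-py (inj₁ (refl , refl))))

    back : Twistable G r x (p x)
    back = record
      { y≢x       = px≢x
      ; y≢px      = λ px≡rx → px≢y (trans px≡rx r-x)
      ; adj-x-y   = adjacent P x
      ; adj-px-py = subst₂ (λ a b → adj G a b ≡ true) (sym r-x) (sym r-px) (adjacent P y)
      }

    module R′ = Twist G R back

    r′-away : ∀ {z} → z ≢ x → z ≢ y → z ≢ p x → z ≢ p y → R′.q z ≡ r z
    r′-away z≢x z≢y z≢px z≢py =
      R′.q-away z≢x z≢px (λ z≡rx → z≢y (trans z≡rx r-x)) (λ z≡rpx → z≢py (trans z≡rpx r-px))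

    S⊆r′ : S ⊆ₑ edgesOf R′.q
    S⊆r′ i j Sij = edgesOf-complete R′.q {i} (r′i≡j (locate p x y i))
      where
      r′i≡j : Location p x y i → R′.q i ≡ j
      r′i≡j (at-x refl)  = trans R′.q-x (S-in-p Sij)
      r′i≡j (at-px refl) = trans R′.q-y (trans (sym (involutive P x)) (S-in-p Sij))
      r′i≡j (at-y refl)  = trans (cong R′.q (sym r-x)) (trans R′.q-px (trans r-px (S-in-p Sij)))
      r′i≡j (at-py refl) =
        trans (cong R′.q (sym r-px)) (trans R′.q-py (trans r-x (trans (sym (involutive P y)) (S-in-p Sij))))
      r′i≡j (away i≢x i≢y i≢px i≢py) =
        trans (r′-away i≢x i≢y i≢px i≢py) (in-r (S′-complete (old Sij i≢x i≢y i≢px i≢py)))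

    r≗q : r ≗ q
    r≗q z with locate p x y z
    ... | at-x refl  = trans r-x (sym q-x)
    ... | at-y refl  = trans (trans (cong r (sym r-x)) (involutive R x)) (sym q-y)
    ... | at-px refl = trans r-px (sym q-px)
    ... | at-py refl = trans (trans (cong r (sym r-px)) (involutive R (p x))) (sym q-py)
    ... | away z≢x z≢y z≢px z≢py =
      trans (sym (r′-away z≢x z≢y z≢px z≢py))
            (trans (forcingSet-forces-mate G {p = p} F R′.isMate S⊆r′ z) (sym (q-away z≢x z≢y z≢px z≢py)))

  S′-isForcingSet : IsForcingSet G (edgesOf q) S′
  S′-isForcingSet = S′-symmetric , S′⊆q , forces
    where
    forces : ∀ M″ → IsPerfectMatching G M″ → S′ ⊆ₑ M″ → M″ ≐ edgesOf q
    forces M″ pm S′⊆M″ =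
      let r , R , M″≐r = mateOf G pm
          S′⊆r : S′ ⊆ₑ edgesOf r
          S′⊆r i j S′ij = trans (sym (M″≐r i j)) (S′⊆M″ i j S′ij)
      in λ i j → trans (M″≐r i j) (edgesOf-cong (Back.r≗q R S′⊆r) i j)

  S-near : ∀ {z} → S z (p z) ≡ false → ∀ {i j} → S i j ≡ true → i ≢ z × i ≢ p z
  S-near {z} Sz≡false {i} {j} Sij =
    (λ { refl → absent (subst (λ k → S i k ≡ true) (sym (S-in-p Sij)) Sij) }) ,
    (λ { refl → absent (trans (proj₁ F z i)
                              (subst (λ k → S i k ≡ true) (trans (sym (S-in-p Sij)) (involutive P z)) Sij)) })
    where
    absent : S z (p z) ≢ true
    absent Sz≡true = contradiction (trans (sym Sz≡false) Sz≡true) λ ()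

  -- S cannot avoid both switched edges, for otherwise it would also be contained in q.
  edgeCount-kept< : edgeCount kept < edgeCount S
  edgeCount-kept< with S x (p x) in Sx | S y (p y) in Sy
  ... | true  | _    = begin-strict
    edgeCount kept                        ≤⟨ edgeCount-mono {S = kept} {T = S ∖ₑ edge x (p x)} ∖ₑ-⊆ ⟩
    edgeCount (S ∖ₑ edge x (p x))         <⟨ ≤-reflexive (sym (edgeCount-∖edge (proj₁ F) (px≢x ∘ sym) Sx)) ⟩
    edgeCount S                           ∎
    where open ≤-Reasoning
  ... | false | true = begin-strict
    edgeCount kept                        ≤⟨ edgeCount-mono {S = kept} {T = S ∖ₑ edge y (p y)}
                                                 (∖ₑ-monoˡ {S = S ∖ₑ edge x (p x)} {S′ = S} {T = edge y (p y)} ∖ₑ-⊆) ⟩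
    edgeCount (S ∖ₑ edge y (p y))         <⟨ ≤-reflexive (sym (edgeCount-∖edge (proj₁ F) (py≢y ∘ sym) Sy)) ⟩
    edgeCount S                           ∎
    where open ≤-Reasoning
  ... | false | false = ⊥-elim (y≢px C (trans (sym q-x) (forcingSet-forces-mate G {p = p} F isMate S⊆q x)))
    where
    S⊆q : S ⊆ₑ edgesOf q
    S⊆q i j Sij with locate p x y i
    ... | at-x  i≡x  = ⊥-elim (proj₁ (S-near Sx Sij) i≡x)
    ... | at-px i≡px = ⊥-elim (proj₂ (S-near Sx Sij) i≡px)
    ... | at-y  i≡y  = ⊥-elim (proj₁ (S-near Sy Sij) i≡y)
    ... | at-py i≡py = ⊥-elim (proj₂ (S-near Sy Sij) i≡py)
    ... | away i≢x i≢y i≢px i≢py = edgesOf-complete q {i} (trans (q-away i≢x i≢y i≢px i≢py) (S-in-p Sij))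

  edgeCount-S′ : edgeCount S′ ≤ suc (edgeCount S)
  edgeCount-S′ = begin
    edgeCount S′
      ≤⟨ edgeCount-∪ (kept ∪ₑ edge x y) (edge (p x) (p y)) ⟩
    edgeCount (kept ∪ₑ edge x y) + edgeCount (edge (p x) (p y))
      ≤⟨ +-monoˡ-≤ _ (edgeCount-∪ kept (edge x y)) ⟩
    edgeCount kept + edgeCount (edge x y) + edgeCount (edge (p x) (p y))
      ≡⟨ cong₂ (λ a b → edgeCount kept + a + b) (edgeCount-edge (y≢x C ∘ sym)) (edgeCount-edge (py≢px ∘ sym)) ⟩
    edgeCount kept + 1 + 1
      ≡⟨ trans (+-assoc _ 1 1) (+-comm _ 2) ⟩
    suc (suc (edgeCount kept))
      ≤⟨ s≤s edgeCount-kept< ⟩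
    suc (edgeCount S)
      ∎
    where open ≤-Reasoning

forcingNumber-twist : ∀ {m} (G : SimpleGraph m) {p} (P : IsMate G p) {x y} (C : Twistable G p x y) {k k′} →
                      ForcingNumber G (edgesOf p) k → ForcingNumber G (edgesOf (twist p x y)) k′ → k′ ≤ suc k
forcingNumber-twist G P C {k} {k′} ((S , F , |S|≡k) , _) (_ , minimal′) = begin
  k′                  ≤⟨ minimal′ S′ S′-isForcingSet ⟩
  edgeCount S′        ≤⟨ edgeCount-S′ ⟩
  suc (edgeCount S)   ≡⟨ cong suc |S|≡k ⟩
  suc k               ∎
  where
  open TwistForcing G P C F
  open ≤-Reasoning

-- The edges {u , a u} and {v , a v} lie on an a-alternating 4-cycle of G.
AlternatingPair : ∀ {m} → SimpleGraph m → (Fin m → Fin m) → Fin m → Fin m → Set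
AlternatingPair G a u v =
  (adj G u v ≡ true × adj G (a u) (a v) ≡ true) ⊎ (adj G u (a v) ≡ true × adj G (a u) v ≡ true)

module Rival {m : ℕ} (G : SimpleGraph m) {a r : Fin m → Fin m} (A : IsMate G a) (R : IsMate G r)
             {u v : Fin m} (v≢u : v ≢ u) (v≢au : v ≢ a u)
             (agree : ∀ {z} → z ≢ u → z ≢ v → z ≢ a u → z ≢ a v → r z ≡ a z) where

  private
    image-away⇒r≡a : ∀ {z} → r z ≢ u → r z ≢ v → r z ≢ a u → r z ≢ a v → r z ≡ a z
    image-away⇒r≡a {z} rz≢u rz≢v rz≢au rz≢av =
      trans (sym (involutive A (r z))) (cong a (trans (sym (agree rz≢u rz≢v rz≢au rz≢av)) (involutive R z)))

    r-v : r u ≡ a u → r v ≡ a v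
    r-v ru≡au with locate a u v (r v)
    ... | at-x  rv≡u  = ⊥-elim (v≢au (trans (sym (involutive R v)) (trans (cong r rv≡u) ru≡au)))
    ... | at-y  rv≡v  = ⊥-elim (fixpoint-free R v rv≡v)
    ... | at-px rv≡au = ⊥-elim (v≢u (injective R (trans rv≡au (sym ru≡au))))
    ... | at-py rv≡av = rv≡av
    ... | away rv≢u rv≢v rv≢au rv≢av = image-away⇒r≡a rv≢u rv≢v rv≢au rv≢av

    r≗a : r u ≡ a u → r ≗ a
    r≗a ru≡au z with locate a u v z
    ... | at-x  refl = ru≡au
    ... | at-y  refl = r-v ru≡au
    ... | at-px refl = trans (cong r (sym ru≡au)) (trans (involutive R u) (sym (involutive A u)))
    ... | at-py refl = trans (cong r (sym (r-v ru≡au))) (trans (involutive R v) (sym (involutive A v)))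
    ... | away z≢u z≢v z≢au z≢av = agree z≢u z≢v z≢au z≢av

    r-au : r u ≢ a u → r (a u) ≡ v ⊎ r (a u) ≡ a v
    r-au ru≢au with locate a u v (r (a u))
    ... | at-x  rau≡u  = ⊥-elim (ru≢au (trans (cong r (sym rau≡u)) (involutive R (a u))))
    ... | at-y  rau≡v  = inj₁ rau≡v
    ... | at-px rau≡au = ⊥-elim (fixpoint-free R (a u) rau≡au)
    ... | at-py rau≡av = inj₂ rau≡av
    ... | away rau≢u rau≢v rau≢au rau≢av =
      ⊥-elim (rau≢u (trans (image-away⇒r≡a rau≢u rau≢v rau≢au rau≢av) (involutive A u)))

    adj-r : ∀ {z w} → r z ≡ w → adj G z w ≡ true
    adj-r {z} rz≡w = subst (λ w → adj G z w ≡ true) rz≡w (adjacent R z)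

  alternatingPair : ¬ r ≗ a → AlternatingPair G a u v
  alternatingPair r≉a with locate a u v (r u)
  ... | at-x  ru≡u  = ⊥-elim (fixpoint-free R u ru≡u)
  ... | at-px ru≡au = ⊥-elim (r≉a (r≗a ru≡au))
  ... | away ru≢u ru≢v ru≢au ru≢av = ⊥-elim (ru≢au (image-away⇒r≡a ru≢u ru≢v ru≢au ru≢av))
  ... | at-y  ru≡v with r-au (λ ru≡au → v≢au (trans (sym ru≡v) ru≡au))
  ...   | inj₁ rau≡v  = ⊥-elim (fixpoint-free A u (injective R (trans rau≡v (sym ru≡v))))
  ...   | inj₂ rau≡av = inj₁ (adj-r ru≡v , adj-r rau≡av)
  alternatingPair r≉a | at-py ru≡av with r-au (λ ru≡au → v≢u (injective A (trans (sym ru≡av) ru≡au)))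
  ...   | inj₁ rau≡v  = inj₂ (adj-r ru≡av , adj-r rau≡v)
  ...   | inj₂ rau≡av = ⊥-elim (fixpoint-free A u (injective R (trans rau≡av (sym ru≡av))))

module _ {n : ℕ} (G : SimpleGraph (2 * n)) {a : Fin (2 * n) → Fin (2 * n)} (A : IsMate G a)
         (f[a] : ForcingNumber G (edgesOf a) (n ∸ 1)) where

  extremal-alternatingPair : ∀ u v → v ≢ u → v ≢ a u → AlternatingPair G a u v
  extremal-alternatingPair u v v≢u v≢au = from-rival (rival-of-¬forcing G ¬forcing symS S⊆a)
    where
    -- removing two edges leaves a set of n − 2 < f(G, a) edges, which therefore cannot force a
    S : EdgeRel (2 * n)
    S = edgesOf a ∖ₑ edge u (a u) ∖ₑ edge v (a v)
    symS : SymmetricE S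
    symS = ∖ₑ-symmetric (∖ₑ-symmetric (edgesOf-symmetric A) (edge-symmetric u (a u))) (edge-symmetric v (a v))
    S⊆a : S ⊆ₑ edgesOf a
    S⊆a i j = ∖ₑ-⊆ {S = edgesOf a} {T = edge u (a u)} i j ∘ ∖ₑ-⊆ {S = edgesOf a ∖ₑ edge u (a u)} {T = edge v (a v)} i j
    a-v-kept : (edgesOf a ∖ₑ edge u (a u)) v (a v) ≡ true
    a-v-kept = ∧-not-intro (edgesOf-complete a refl) (edge-absent u (a u) {v} {a v} λ
      { (inj₁ (v≡u , _)) → v≢u v≡u ; (inj₂ (v≡au , _)) → v≢au v≡au })
    edgeCount-S : suc (suc (edgeCount S)) ≡ n
    edgeCount-S = begin
      suc (suc (edgeCount S))                      ≡⟨ cong suc (edgeCount-∖edge symA∖u (fixpoint-free A v ∘ sym)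
                                                                                  a-v-kept) ⟨
      suc (edgeCount (edgesOf a ∖ₑ edge u (a u)))  ≡⟨ edgeCount-∖edge (edgesOf-symmetric A) (fixpoint-free A u ∘ sym)
                                                                        (edgesOf-complete a refl) ⟨
      edgeCount (edgesOf a)                        ≡⟨ *-cancelˡ-≡ _ n 2 (edgeCount-mate G A) ⟩
      n                                            ∎
      where
      open ≡-Reasoning
      symA∖u = ∖ₑ-symmetric (edgesOf-symmetric A) (edge-symmetric u (a u))
    ¬forcing : ¬ IsForcingSet G (edgesOf a) S
    ¬forcing F = n≮n (edgeCount S) (subst (_≤ edgeCount S) (cong (_∸ 1) (sym edgeCount-S)) (proj₂ f[a] S F))
    a-kept : ∀ {z} → z ≢ u → z ≢ v → z ≢ a u → z ≢ a v → S z (a z) ≡ true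
    a-kept {z} z≢u z≢v z≢au z≢av = ∧-not-intro
      (∧-not-intro (edgesOf-complete a refl)
                   (edge-absent u (a u) {z} {a z} λ { (inj₁ (z≡u , _)) → z≢u z≡u ; (inj₂ (z≡au , _)) → z≢au z≡au }))
      (edge-absent v (a v) {z} {a z} λ { (inj₁ (z≡v , _)) → z≢v z≡v ; (inj₂ (z≡av , _)) → z≢av z≡av })
    from-rival : (∃ λ M′ → IsPerfectMatching G M′ × S ⊆ₑ M′ × ¬ M′ ≐ edgesOf a) → AlternatingPair G a u v
    from-rival (M′ , pm , S⊆M′ , M′≉a) = let r , R , M′≐r = mateOf G pm in
      Rival.alternatingPair G A R v≢u v≢au
        (λ {z} z≢u z≢v z≢au z≢av →
           edgesOf-sound r (trans (sym (M′≐r z (a z))) (S⊆M′ z (a z) (a-kept z≢u z≢v z≢au z≢av))))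
        (λ r≗a → M′≉a λ i j → trans (M′≐r i j) (edgesOf-cong r≗a i j))

module _ {m : ℕ} (G : SimpleGraph m) where

  data TwistPath : (Fin m → Fin m) → (Fin m → Fin m) → Set where
    done : ∀ {p q} → p ≗ q → TwistPath p q
    step : ∀ {p q x y} → Twistable G p x y → TwistPath (twist p x y) q → TwistPath p q

module Closeness {m : ℕ} (G : SimpleGraph m) (a : Fin m → Fin m) where

  Mismatch : (Fin m → Fin m) → Fin m → Set
  Mismatch p z = p z ≢ a z

  mismatches : (Fin m → Fin m) → ℕ
  mismatches p = ∑[ w < m ] 𝟙 (does (¬? (p w ≟ a w)))

  mismatches-< : ∀ {p p′} → (∀ w → p w ≡ a w → p′ w ≡ a w) → ∀ v → p′ v ≡ a v → Mismatch p v →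
                 mismatches p′ < mismatches p
  mismatches-< {p} {p′} keeps v p′v≡av pv≢av =
    ∑-mono-< pointwise v (subst₂ _<_ (sym (gone v p′v≡av)) (sym (here v pv≢av)) (s≤s z≤n))
    where
    gone : ∀ w → p′ w ≡ a w → 𝟙 (does (¬? (p′ w ≟ a w))) ≡ 0
    gone w e rewrite dec-true (p′ w ≟ a w) e = refl
    here : ∀ w → p w ≢ a w → 𝟙 (does (¬? (p w ≟ a w))) ≡ 1
    here w ne rewrite dec-false (p w ≟ a w) ne = refl
    pointwise : ∀ w → 𝟙 (does (¬? (p′ w ≟ a w))) ≤ 𝟙 (does (¬? (p w ≟ a w)))
    pointwise w with p w ≟ a w
    ... | yes pw≡aw = ≤-reflexive (gone w (keeps w pw≡aw))
    ... | no _ with p′ w ≟ a w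
    ...   | yes _ = z≤n
    ...   | no _  = ≤-refl

  -- The twist path from p to p′ is kept as a prefix operation, so that paths never need concatenating.
  Closer : (Fin m → Fin m) → Set
  Closer p = ∃ λ p′ → IsMate G p′ × mismatches p′ < mismatches p ×
                      (∀ {q} → TwistPath G p′ q → TwistPath G p q)

  private
    twist-keeps-matches : ∀ {p₀ p x y} → Mismatch p₀ x → Mismatch p₀ y → Mismatch p₀ (p x) → Mismatch p₀ (p y) →
                          ∀ w → p₀ w ≡ a w → twist p x y w ≡ p w
    twist-keeps-matches {p₀} {p} {x} {y} mx my mpx mpy w p₀w≡aw =
      twist-away p x y (apart mx) (apart my) (apart mpx) (apart mpy)
      where
      apart : ∀ {z} → Mismatch p₀ z → w ≢ z
      apart p₀z≢az refl = p₀z≢az p₀w≡aw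

  closer-by-twist : ∀ {p x y} → IsMate G p → (C : Twistable G p x y) →
                    Mismatch p x → Mismatch p y → Mismatch p (p x) → Mismatch p (p y) →
                    ∀ v → twist p x y v ≡ a v → Mismatch p v → Closer p
  closer-by-twist {p} {x} {y} P C mx my mpx mpy v matched mv =
    twist p x y , Twist.isMate G P C , mismatches-< keeps v matched mv , step C
    where
    keeps : ∀ w → p w ≡ a w → twist p x y w ≡ a w
    keeps w pw≡aw = trans (twist-keeps-matches mx my mpx mpy w pw≡aw) pw≡aw

  closer-by-two-twists : ∀ {p x y x′ y′} → IsMate G p → (C : Twistable G p x y) →
                         (C′ : Twistable G (twist p x y) x′ y′) →
                         Mismatch p x → Mismatch p y → Mismatch p (p x) → Mismatch p (p y) →
                         let p₁ = twist p x y in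
                         Mismatch p x′ → Mismatch p y′ → Mismatch p (p₁ x′) → Mismatch p (p₁ y′) →
                         ∀ v → twist p₁ x′ y′ v ≡ a v → Mismatch p v → Closer p
  closer-by-two-twists {p} {x} {y} {x′} {y′} P C C′ mx my mpx mpy mx′ my′ mpx′ mpy′ v matched mv =
    twist (twist p x y) x′ y′ , Twist.isMate G (Twist.isMate G P C) C′ ,
    mismatches-< keeps v matched mv , λ path → step C (step C′ path)
    where
    keeps : ∀ w → p w ≡ a w → twist (twist p x y) x′ y′ w ≡ a w
    keeps w pw≡aw = trans (twist-keeps-matches mx′ my′ mpx′ mpy′ w pw≡aw)
                          (trans (twist-keeps-matches mx my mpx mpy w pw≡aw) pw≡aw)

module AlternatingCycle {m : ℕ} (G : SimpleGraph m) {a p : Fin m → Fin m} (A : IsMate G a) (P : IsMate G p) where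

  walk : ℕ → Fin m → Fin m
  walk zero    z = z
  walk (suc d) z = p (a (walk d z))

  walk-comm : ∀ d z → walk d (p (a z)) ≡ p (a (walk d z))
  walk-comm zero    z = refl
  walk-comm (suc d) z = cong (p ∘ a) (walk-comm d z)

  walk-+ : ∀ i d z → walk (i + d) z ≡ walk d (walk i z)
  walk-+ zero    d z = refl
  walk-+ (suc i) d z = trans (cong (p ∘ a) (walk-+ i d z)) (sym (walk-comm d (walk i z)))

  -- An a-p-alternating walk returns to its start only after an even number of edges.
  walk-parity : ∀ d z → z ≢ a (walk d z)
  walk-parity zero          z z≡az   = fixpoint-free A z (sym z≡az)
  walk-parity (suc zero)    z z≡apaz = fixpoint-free P (a z) (sym (trans (cong a z≡apaz) (involutive A (p (a z)))))
  walk-parity (suc (suc d)) z z≡a⋯   =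
    walk-parity d (p (a z)) (trans (cong (p ∘ a) z≡a⋯) (trans pa-a-p (cong a (sym (walk-comm d z)))))
    where
    pa-a-p : p (a (a (p (a (p (a (walk d z))))))) ≡ a (p (a (walk d z)))
    pa-a-p = trans (cong p (involutive A _)) (involutive P _)

  -- t₀ –a– s₀ –p– t₁ –a– s₁ –p– t₂ ⋯ runs along the cycle of a △ p through t₀.
  module Through (t₀ : Fin m) (t₀-mismatch : p t₀ ≢ a t₀) where

    t s : ℕ → Fin m
    t k = walk k t₀
    s k = a (t k)

    p-t : ∀ k → p (t (suc k)) ≡ s k
    p-t k = involutive P (s k)

    t≢s : ∀ i j → t i ≢ s j
    t≢s i j ti≡sj with ≤-total i j
    ... | inj₁ i≤j with d , refl ← m≤n⇒∃[o]m+o≡n i≤j =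
      walk-parity d (t i) (trans ti≡sj (cong a (walk-+ i d t₀)))
    ... | inj₂ j≤i with d , refl ← m≤n⇒∃[o]m+o≡n j≤i =
      walk-parity d (t j) (trans (sym (involutive A (t j))) (cong a (trans (sym ti≡sj) (walk-+ j d t₀))))

    t-cancelˡ : ∀ k {i j} → t (k + i) ≡ t (k + j) → t i ≡ t j
    t-cancelˡ zero    e = e
    t-cancelˡ (suc k) e = t-cancelˡ k (injective A (injective P e))

    t-cancelʳ : ∀ k {i j} → t (i + k) ≡ t (j + k) → t i ≡ t j
    t-cancelʳ k {i} {j} e = t-cancelˡ k (trans (cong t (+-comm k i)) (trans e (cong t (+-comm j k))))

    t-suc≢ : ∀ k → t (suc k) ≢ t k
    t-suc≢ k e = t₁≢t₀ (t-cancelʳ k {1} {0} e)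
      where
      t₁≢t₀ : t 1 ≢ t 0
      t₁≢t₀ t₁≡t₀ = t₀-mismatch (trans (sym (cong p t₁≡t₀)) (involutive P (a t₀)))

    t-mismatch : ∀ k → p (t k) ≢ a (t k)
    t-mismatch zero    = t₀-mismatch
    t-mismatch (suc k) e = t-suc≢ k (sym (injective A (trans (sym (p-t k)) e)))

    s-mismatch : ∀ k → p (s k) ≢ a (s k)
    s-mismatch k e = t-suc≢ k (trans e (involutive A (t k)))

module Reach {m : ℕ} (G : SimpleGraph m) {a : Fin m → Fin m} (A : IsMate G a)
             (pairs : ∀ u v → v ≢ u → v ≢ a u → AlternatingPair G a u v) where

  open Closeness G a

  private
    Adj : Fin m → Fin m → Set
    Adj u v = adj G u v ≡ true

    adj-sym : ∀ {u v} → Adj u v → Adj v u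
    adj-sym {u} {v} = trans (SimpleGraph.sym G v u)

  module _ {p : Fin m → Fin m} (P : IsMate G p) (t₀ : Fin m) (t₀-mismatch : Mismatch p t₀) where

    open AlternatingCycle G A P
    open Through t₀ t₀-mismatch

    private
      adj-a : ∀ k → Adj (t k) (s k)
      adj-a k = adjacent A (t k)

      mismatch-≡ : ∀ {u v} → u ≡ v → Mismatch p v → Mismatch p u
      mismatch-≡ refl mv = mv

      t-shift : ∀ k {i j} → t i ≢ t j → t (i + k) ≢ t (j + k)
      t-shift k {i} {j} ti≢tj e = ti≢tj (t-cancelʳ k {i} {j} e)

      pair : ∀ i j → t j ≢ t i → AlternatingPair G a (t i) (t j)
      pair i j tj≢ti = pairs (t i) (t j) tj≢ti (t≢s j i)

    -- Each close-… turns the chords of the cycle in its hypotheses into one or two twists that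
    -- put an a-edge of the cycle into the matching.
    close-s-t : ∀ k → Adj (s k) (t (2 + k)) → Closer p
    close-s-t k s~t =
      closer-by-twist P C (s-mismatch k) (t-mismatch (2 + k)) (t-mismatch (1 + k))
                          (mismatch-≡ (p-t (1 + k)) (s-mismatch (1 + k)))
                          (t (1 + k)) (trans (Twist.q-px G P C) (p-t (1 + k))) (t-mismatch (1 + k))
      where
      C : Twistable G p (s k) (t (2 + k))
      C = record
        { y≢x = t≢s (2 + k) k ; y≢px = t-suc≢ (1 + k) ; adj-x-y = s~t
        ; adj-px-py = subst (Adj (t (1 + k))) (sym (p-t (1 + k))) (adj-a (1 + k)) }

    close-s-s : ∀ j → t 2 ≢ t 0 → Adj (s j) (s (2 + j)) → Adj (t (1 + j)) (t (3 + j)) → Adj (s j) (s (1 + j)) →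
                Closer p
    close-s-s j t₂≢t₀ s~s t~t s~s′ =
      closer-by-two-twists P C₁ C₂ (s-mismatch j) (s-mismatch (2 + j)) (t-mismatch (1 + j)) (t-mismatch (3 + j))
                           (s-mismatch (1 + j)) (s-mismatch j)
                           (mismatch-≡ p₁x′ (t-mismatch (2 + j))) (mismatch-≡ p₁y′ (s-mismatch (2 + j)))
                           (t (2 + j)) matched (t-mismatch (2 + j))
      where
      C₁ : Twistable G p (s j) (s (2 + j))
      C₁ = record
        { y≢x = λ e → t₂≢t₀ (t-cancelʳ j {2} {0} (injective A e)) ; y≢px = λ e → t≢s (1 + j) (2 + j) (sym e)
        ; adj-x-y = s~s ; adj-px-py = t~t }
      p₁ = twist p (s j) (s (2 + j))
      p₁x′ : p₁ (s (1 + j)) ≡ t (2 + j)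
      p₁x′ = twist-away p (s j) (s (2 + j))
                        (λ e → t-suc≢ j (injective A e)) (λ e → t-suc≢ (1 + j) (sym (injective A e)))
                        (λ e → t≢s (1 + j) (1 + j) (sym e)) (λ e → t≢s (3 + j) (1 + j) (sym e))
      p₁y′ : p₁ (s j) ≡ s (2 + j)
      p₁y′ = twist-x p (s j) (s (2 + j))
      C₂ : Twistable G p₁ (s (1 + j)) (s j)
      C₂ = record
        { y≢x = λ e → t-suc≢ j (sym (injective A e)) ; y≢px = λ e → t≢s (2 + j) j (sym (trans e p₁x′))
        ; adj-x-y = adj-sym s~s′ ; adj-px-py = subst₂ Adj (sym p₁x′) (sym p₁y′) (adj-a (2 + j)) }
      matched : twist p₁ (s (1 + j)) (s j) (t (2 + j)) ≡ s (2 + j)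
      matched = trans (cong (twist p₁ (s (1 + j)) (s j)) (sym p₁x′))
                      (trans (Twist.q-px G (Twist.isMate G P C₁) C₂) p₁y′)

    close-s₀-t₃ : t 2 ≢ t 0 → Adj (s 0) (t 3) → Adj (t 1) (s 2) → Closer p
    close-s₀-t₃ t₂≢t₀ s₀~t₃ t₁~s₂ =
      closer-by-two-twists P C₁ C₂ (s-mismatch 0) (t-mismatch 3) (t-mismatch 1) (mismatch-≡ (p-t 2) (s-mismatch 2))
                           (t-mismatch 1) (s-mismatch 1)
                           (mismatch-≡ p₁x′ (s-mismatch 2)) (mismatch-≡ p₁y′ (t-mismatch 2))
                           (t 1) (twist-x p₁ (t 1) (s 1)) (t-mismatch 1)
      where
      C₁ : Twistable G p (s 0) (t 3)
      C₁ = record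
        { y≢x = t≢s 3 0 ; y≢px = λ e → t₂≢t₀ (t-cancelʳ 1 {2} {0} e)
        ; adj-x-y = s₀~t₃ ; adj-px-py = subst (Adj (t 1)) (sym (p-t 2)) t₁~s₂ }
      p₁ = twist p (s 0) (t 3)
      p₁x′ : p₁ (t 1) ≡ s 2
      p₁x′ = trans (Twist.q-px G P C₁) (p-t 2)
      p₁y′ : p₁ (s 1) ≡ t 2
      p₁y′ = twist-away p (s 0) (t 3) (λ e → t-suc≢ 0 (injective A e)) (λ e → t≢s 3 1 (sym e)) (λ e → t≢s 1 1 (sym e))
                              (λ e → t-suc≢ 1 (sym (injective A (trans e (p-t 2)))))
      C₂ : Twistable G p₁ (t 1) (s 1)
      C₂ = record
        { y≢x = λ e → t≢s 1 1 (sym e) ; y≢px = λ e → t-suc≢ 1 (sym (injective A (trans e p₁x′)))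
        ; adj-x-y = adj-a 1 ; adj-px-py = subst₂ Adj (sym p₁x′) (sym p₁y′) (adj-sym (adj-a 2)) }

    close-s₁-s₃ : t 2 ≢ t 0 → t 3 ≢ t 0 → Adj (s 1) (s 3) → Adj (t 2) (t 4) → Adj (s 0) (s 3) → Closer p
    close-s₁-s₃ t₂≢t₀ t₃≢t₀ s₁~s₃ t₂~t₄ s₀~s₃ =
      closer-by-two-twists P C₁ C₂ (s-mismatch 1) (s-mismatch 3) (t-mismatch 2) (t-mismatch 4)
                           (s-mismatch 0) (s-mismatch 3)
                           (mismatch-≡ p₁x′ (t-mismatch 1)) (mismatch-≡ p₁y′ (s-mismatch 1))
                           (t 1) matched (t-mismatch 1)
      where
      C₁ : Twistable G p (s 1) (s 3)
      C₁ = record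
        { y≢x = λ e → t₂≢t₀ (t-cancelʳ 1 {2} {0} (injective A e)) ; y≢px = λ e → t≢s 2 3 (sym e)
        ; adj-x-y = s₁~s₃ ; adj-px-py = t₂~t₄ }
      p₁ = twist p (s 1) (s 3)
      p₁x′ : p₁ (s 0) ≡ t 1
      p₁x′ = twist-away p (s 1) (s 3) (λ e → t-suc≢ 0 (sym (injective A e))) (λ e → t₃≢t₀ (sym (injective A e)))
                              (λ e → t≢s 2 0 (sym e)) (λ e → t≢s 4 0 (sym e))
      p₁y′ : p₁ (s 3) ≡ s 1
      p₁y′ = Twist.q-y G P C₁
      C₂ : Twistable G p₁ (s 0) (s 3)
      C₂ = record
        { y≢x = λ e → t₃≢t₀ (injective A e) ; y≢px = λ e → t≢s 1 3 (sym (trans e p₁x′))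
        ; adj-x-y = s₀~s₃ ; adj-px-py = subst₂ Adj (sym p₁x′) (sym p₁y′) (adj-a 1) }
      matched : twist p₁ (s 0) (s 3) (t 1) ≡ s 1
      matched = trans (cong (twist p₁ (s 0) (s 3)) (sym p₁x′)) (trans (Twist.q-px G (Twist.isMate G P C₁) C₂) p₁y′)

    -- Five vertices t₀ … t₄ of the cycle suffice: the pairs of a-edges among them either give a
    -- shortcut of the cycle directly or one of the two-twist configurations above.
    closer : Closer p
    closer with t 2 ≟ t 0
    ... | yes t₂≡t₀ = close-s-t 0 (subst (Adj (s 0)) (sym t₂≡t₀) (adj-sym (adj-a 0)))
    ... | no t₂≢t₀ with pair 0 2 t₂≢t₀ | pair 1 3 (t-shift 1 {2} {0} t₂≢t₀)
    ...   | inj₂ (_ , s₀~t₂)  | _                   = close-s-t 0 s₀~t₂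
    ...   | inj₁ _            | inj₂ (_ , s₁~t₃)   = close-s-t 1 s₁~t₃
    ...   | inj₁ (_ , s₀~s₂)  | inj₁ (t₁~t₃ , s₁~s₃) = long-cycle t₂≢t₀ s₀~s₂ t₁~t₃ s₁~s₃
      where
      long-cycle : t 2 ≢ t 0 → Adj (s 0) (s 2) → Adj (t 1) (t 3) → Adj (s 1) (s 3) → Closer p
      long-cycle t₂≢t₀ s₀~s₂ t₁~t₃ s₁~s₃ with adj G (s 0) (s 1) in s₀s₁
      ... | true = close-s-s 0 t₂≢t₀ s₀~s₂ t₁~t₃ s₀s₁
      ... | false with t 3 ≟ t 0
      ...   | yes t₃≡t₀ = contradiction (trans (sym s₀s₁) (adj-sym (subst (Adj (s 1)) (cong a t₃≡t₀) s₁~s₃))) λ ()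
      ...   | no t₃≢t₀ with pair 0 3 t₃≢t₀ | pair 2 4 (t-shift 2 {2} {0} t₂≢t₀)
      ...     | _                | inj₂ (_ , s₂~t₄) = close-s-t 2 s₂~t₄
      ...     | inj₁ (_ , s₀~s₃) | inj₁ (t₂~t₄ , _) = close-s₁-s₃ t₂≢t₀ t₃≢t₀ s₁~s₃ t₂~t₄ s₀~s₃
      ...     | inj₂ (_ , s₀~t₃) | inj₁ (t₂~t₄ , _) with adj G (t 1) (s 2) in t₁s₂
      ...       | true = close-s₀-t₃ t₂≢t₀ s₀~t₃ t₁s₂
      ...       | false with pair 1 2 (t-suc≢ 1)
      ...         | inj₂ (t₁~s₂ , _) = contradiction (trans (sym t₁s₂) t₁~s₂) λ ()
      ...         | inj₁ (_ , s₁~s₂) = close-s-s 1 t₂≢t₀ s₁~s₃ t₂~t₄ s₁~s₂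

  twistPath-from-acc : ∀ {p} → IsMate G p → Acc _<_ (mismatches p) → TwistPath G p a
  twistPath-from-acc {p} P (acc smaller) with any? (λ v → ¬? (p v ≟ a v))
  ... | no ∄mismatch = done λ z → decidable-stable (p z ≟ a z) (λ pz≢az → ∄mismatch (z , pz≢az))
  ... | yes (t₀ , t₀-mismatch) =
    let p′ , P′ , fewer , extend = closer P t₀ t₀-mismatch in extend (twistPath-from-acc P′ (smaller fewer))

  twistPath : ∀ {p} → IsMate G p → TwistPath G p a
  twistPath P = twistPath-from-acc P (<-wellFounded _)

module _ {m : ℕ} (G : SimpleGraph m) where

  -- Discrete intermediate values: one twist raises the forcing number by at most one.
  spectrum-along : ∀ {p q x y k} → TwistPath G p q → IsMate G p →
                   ForcingNumber G (edgesOf p) x → ForcingNumber G (edgesOf q) y → x ≤ k → k ≤ y → InSpectrum G k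
  spectrum-along {p} {x = x} {k = k} (done p≗q) P f[p] f[q] x≤k k≤y =
    edgesOf p , isPerfectMatching-edgesOf G P , subst (ForcingNumber G (edgesOf p)) x≡k f[p]
    where
    x≡k : x ≡ k
    x≡k = ≤-antisym x≤k (subst (k ≤_) (sym x≡y) k≤y)
      where
      x≡y = forcingNumber-unique G f[p] (forcingNumber-cong G (≐-sym (edgesOf-cong p≗q)) f[q])
  spectrum-along {p} {x = x} {k = k} (step C path) P f[p] f[q] x≤k k≤y with x ≟ℕ k
  ... | yes refl = edgesOf p , isPerfectMatching-edgesOf G P , f[p]
  ... | no x≢k =
    let P′ = Twist.isMate G P C
        x′ , f[p′] = forcingNumber-exists G (isPerfectMatching-edgesOf G P′)
    in spectrum-along path P′ f[p′] f[q] (≤-trans (forcingNumber-twist G P C f[p] f[p′]) (≤∧≢⇒< x≤k x≢k)) k≤y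

theorem5p9 : (n : ℕ) → 1 ≤ n → (G : SimpleGraph (2 * n)) →
    HasPerfectMatching G → MaxForcingNumber G (n ∸ 1) →
    ContinuousSpectrum G
theorem5p9 n _ G _ ((M₀ , pm₀ , f[M₀]) , maximal) x y k (_ , pm , f[M]) inSpectrum-y x≤k k≤y =
  let a , A , M₀≐a = mateOf G pm₀
      p , P , M≐p  = mateOf G pm
      f[a] = forcingNumber-cong G M₀≐a f[M₀]
  in spectrum-along G (Reach.twistPath G A (extremal-alternatingPair {n} G A f[a]) P) P
                    (forcingNumber-cong G M≐p f[M]) f[a] x≤k (≤-trans k≤y (maximal y inSpectrum-y))
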